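{- Let $n\geq 6$ and $d>2$ be integers. Then $\operatorname{im}(P_n^d)=2d+1$, where $P_n^d$ denotes the Cartesian product of $d$ copies of the path $P_n$.
   Context: All graphs are finite and simple; $P_n$ is the path on $n$ vertices. A graph $G$ has a $G'$-immersion if there is an injective map $\phi:V(G')\to V(G)$ such that for every edge $uv\in E(G')$ there is a path in $G$ joining $\phi(u)$ and $\phi(v)$, and these paths are pairwise edge-disjoint. The immersion number $\operatorname{im}(G)$ is the largest $t$ such that $G$ has a $K_t$-immersion. The Cartesian product $G\,\Box\, H$ has vertex set $V(G)\times V(H)$, with $(g,h)$ adjacent to $(g',h')$ iff $g=g'$ and $hh'\in E(H)$, or $gg'\in E(G)$ and $h=h'$. -}

module Defs where

open import Level using (0ℓ)
open import Data.Nat using (ℕ; zero; suc; _≤_; _<_)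
open import Data.Fin using (Fin; toℕ) renaming (_<_ to _<ᶠ_)
open import Data.Unit using (⊤)
open import Data.Empty using (⊥)
open import Data.Product using (Σ; _×_; _,_)
open import Data.Sum using (_⊎_)
open import Data.List using (List; []; _∷_)
open import Data.List.Relation.Unary.Unique.Propositional using (Unique)
open import Relation.Binary.PropositionalEquality using (_≡_)
open import Relation.Nullary using (¬_)
open import Function.Definitions using (Injective)

-- A graph: a vertex type and an adjacency relation.
-- (All graphs built below are finite, simple: adjacency is symmetric, irreflexive.)
record Graph : Set₁ where
  field
    V   : Set
    Adj : V → V → Set
open Graph public

PathGraph : ℕ → Graph
PathGraph n = record
  { V = Fin n
  ; Adj = λ x y → (toℕ y ≡ suc (toℕ x)) ⊎ (toℕ x ≡ suc (toℕ y)) }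

K1 : Graph
K1 = record { V = ⊤ ; Adj = λ _ _ → ⊥ }

_□_ : Graph → Graph → Graph
G □ H = record
  { V = V G × V H
  ; Adj = λ { (g , h) (g' , h') →
        (g ≡ g' × Adj H h h') ⊎ (Adj G g g' × h ≡ h') } }

_^□_ : Graph → ℕ → Graph
G ^□ zero  = K1
G ^□ suc d = G □ (G ^□ d)

module _ (G : Graph) where

  data Walk : V G → V G → Set where
    stop : (a : V G) → Walk a a
    step : {a b c : V G} → Adj G a b → Walk b c → Walk a c

  vertices : {a b : V G} → Walk a b → List (V G)
  vertices (stop a) = a ∷ []
  vertices (step {a} _ w) = a ∷ vertices w

  Step : {a b : V G} → Walk a b → V G → V G → Set
  Step (stop a) x y = ⊥
  Step (step {a} {b} _ w) x y = (a ≡ x × b ≡ y) ⊎ Step w x y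

  UsesEdge : {a b : V G} → Walk a b → V G → V G → Set
  UsesEdge w x y = Step w x y ⊎ Step w y x

  record Path (a b : V G) : Set where
    field
      walk     : Walk a b
      distinct : Unique (vertices walk)
  open Path public

  EdgeDisjoint : {a b c d : V G} → Path a b → Path c d → Set
  EdgeDisjoint p q = ∀ x y → UsesEdge (walk p) x y → ¬ UsesEdge (walk q) x y

  HasKImmersion : ℕ → Set
  HasKImmersion t =
    Σ (Fin t → V G) λ φ → Injective _≡_ _≡_ φ ×
    Σ ((i j : Fin t) → i <ᶠ j → Path (φ i) (φ j)) λ P →
      ∀ i j (i<j : i <ᶠ j) k l (k<l : k <ᶠ l) →
        ¬ (i ≡ k × j ≡ l) → EdgeDisjoint (P i j i<j) (P k l k<l)

  ImmersionNumberIs : ℕ → Set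
  ImmersionNumberIs t = HasKImmersion t × (∀ s → HasKImmersion s → s ≤ t)

module Submission where

-- Upper bound.  In a K_s-immersion the s - 1 paths leaving the branch vertex φ 0 begin
-- with pairwise distinct edges, so s ≤ deg(φ 0) + 1.  Degrees are bounded through an
-- injective labelling of the edges at each vertex; the labelling of a Cartesian product
-- combines those of its factors, so every vertex of P_n^d has at most 2d neighbours.
--
-- Lower bound, by induction on d.  A "spare immersion" is a K_{t+1}-immersion together
-- with a neighbour of the branch vertex φ 0 that is not itself a branch vertex.  For
-- d = 3 an explicit spare K_7-immersion in P_n^3 is written down (coordinates ≤ 5, so
-- n ≥ 6 is needed) and verified by evaluation.  The extension step turns a spare
-- K_{t+1}-immersion in any graph G into a spare K_{t+3}-immersion in P_N □ G (N ≥ 5),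
-- using five consecutive layers of P_N □ G.

open import Defs
open import Data.Bool using (Bool; true; false; if_then_else_; _∧_)
import Data.Bool.Properties as Bool
open import Data.Nat using (ℕ; zero; suc; _≤_; _<_; _+_; _*_; z≤n; s≤s; _≡ᵇ_)
import Data.Nat.Properties as ℕ
open import Data.Nat.Properties using (*-comm; +-comm; m≤n⇒∃[o]m+o≡n)
import Data.Nat.Literals as NatLiterals
open import Data.Fin using (Fin; zero; suc; toℕ; join; splitAt; _↑ˡ_) renaming (_<_ to _<ᶠ_)
open import Data.Fin.Properties using (toℕ-injective; suc-injective; injective⇒≤; splitAt-join; all?)
  renaming (_≟_ to _≟ᶠ_; _<?_ to _<ᶠ?_)
import Data.Fin.Literals as FinLiterals
open import Data.Unit using (tt)
import Data.Unit.Properties as Unit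
open import Data.Empty using (⊥-elim)
open import Data.Product using (Σ; _×_; _,_; proj₁; proj₂; swap)
import Data.Product.Properties as Product
open import Data.Sum using (_⊎_; inj₁; inj₂)
import Data.Sum.Properties as Sum
open import Data.List using (List; []; _∷_; [_]; _++_; map)
open import Data.List.Relation.Unary.All as All using (All; [])
open import Data.List.Relation.Unary.AllPairs using ([]; _∷_)
open import Data.List.Relation.Unary.Any using (here; there)
open import Data.List.Relation.Unary.Unique.Propositional using (Unique)
import Data.List.Relation.Unary.Unique.Propositional.Properties as Unique
open import Data.List.Membership.Propositional using (_∈_; _∉_)
open import Data.List.Membership.Propositional.Properties using (∈-map⁻)
open import Data.Vec using (_∷_; []; lookup)
open import Relation.Binary.PropositionalEquality using (_≡_; _≢_; refl; sym; trans; cong; subst)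
open import Relation.Binary.Definitions using (DecidableEquality)
open import Relation.Nullary using (¬_; Dec; yes; no; ¬?)
open import Relation.Nullary.Decidable using (_×-dec_; _⊎-dec_; _→-dec_; toWitness)
open import Function.Definitions using (Injective)

module _ {G : Graph} where

  _▷_ : {a b c : V G} → Walk G a b → Adj G b c → Walk G a c
  stop a   ▷ e = step e (stop _)
  step f w ▷ e = step f (w ▷ e)

  vertices-▷ : {a b c : V G} (w : Walk G a b) (e : Adj G b c) →
    vertices G (w ▷ e) ≡ vertices G w ++ [ c ]
  vertices-▷ (stop a)   e = refl
  vertices-▷ (step f w) e = cong (_ ∷_) (vertices-▷ w e)

  step-▷ : {a b c x y : V G} (w : Walk G a b) (e : Adj G b c) →
    Step G (w ▷ e) x y → Step G w x y ⊎ (b ≡ x × c ≡ y)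
  step-▷ (stop a)   e (inj₁ p) = inj₂ p
  step-▷ (step f w) e (inj₁ p) = inj₁ (inj₁ p)
  step-▷ (step f w) e (inj₂ s) with step-▷ w e s
  ... | inj₁ s′ = inj₁ (inj₂ s′)
  ... | inj₂ p  = inj₂ p

  extendPath : {a b c : V G} (p : Path G a b) (e : Adj G b c) →
    c ∉ vertices G (walk p) → Path G a c
  extendPath p e c∉p = record
    { walk     = walk p ▷ e
    ; distinct = subst Unique (sym (vertices-▷ (walk p) e))
                   (Unique.++⁺ (distinct p) ([] ∷ []) λ { (c∈p , here refl) → c∉p c∈p }) }

  trivialPath : (a : V G) → Path G a a
  trivialPath a = record { walk = stop a ; distinct = [] ∷ [] }

  firstStep : {a b : V G} (w : Walk G a b) → a ≢ b →
    Σ (V G) λ c → Adj G a c × Step G w a c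
  firstStep (stop a)           a≢a = ⊥-elim (a≢a refl)
  firstStep (step {b = c} e w) _   = c , e , inj₁ (refl , refl)

module _ {G H : Graph} (f : V G → V H)
         (hom : ∀ {a b} → Adj G a b → Adj H (f a) (f b)) where

  mapWalk : {a b : V G} → Walk G a b → Walk H (f a) (f b)
  mapWalk (stop a)   = stop (f a)
  mapWalk (step e w) = step (hom e) (mapWalk w)

  vertices-mapWalk : {a b : V G} (w : Walk G a b) →
    vertices H (mapWalk w) ≡ map f (vertices G w)
  vertices-mapWalk (stop a)   = refl
  vertices-mapWalk (step e w) = cong (_ ∷_) (vertices-mapWalk w)

  step-mapWalk : {a b : V G} (w : Walk G a b) {x y : V H} → Step H (mapWalk w) x y →
    Σ (V G) λ x′ → Σ (V G) λ y′ → Step G w x′ y′ × f x′ ≡ x × f y′ ≡ y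
  step-mapWalk (step {a} {b} e w) (inj₁ (refl , refl)) = a , b , inj₁ (refl , refl) , refl , refl
  step-mapWalk (step e w)         (inj₂ s) with step-mapWalk w s
  ... | x′ , y′ , s′ , p , q = x′ , y′ , inj₂ s′ , p , q

  usesEdge-mapWalk : {a b : V G} (w : Walk G a b) {x y : V H} → UsesEdge H (mapWalk w) x y →
    Σ (V G) λ x′ → Σ (V G) λ y′ → UsesEdge G w x′ y′ × f x′ ≡ x × f y′ ≡ y
  usesEdge-mapWalk w (inj₁ s) with step-mapWalk w s
  ... | x′ , y′ , s′ , p , q = x′ , y′ , inj₁ s′ , p , q
  usesEdge-mapWalk w (inj₂ s) with step-mapWalk w s
  ... | y′ , x′ , s′ , q , p = x′ , y′ , inj₂ s′ , p , q

  mapPath : Injective _≡_ _≡_ f → {a b : V G} → Path G a b → Path H (f a) (f b)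
  mapPath f-inj p = record
    { walk     = mapWalk (walk p)
    ; distinct = subst Unique (sym (vertices-mapWalk (walk p))) (Unique.map⁺ f-inj (distinct p)) }

-- An injective labelling of the edges leaving each vertex by Fin Δ;
-- its existence says that every vertex has at most Δ neighbours.
record EdgeLabelling (G : Graph) (Δ : ℕ) : Set where
  field
    label           : {a b : V G} → Adj G a b → Fin Δ
    label-injective : {a b c : V G} (e : Adj G a b) (e′ : Adj G a c) → label e ≡ label e′ → b ≡ c
open EdgeLabelling

pathLabelling : (n : ℕ) → EdgeLabelling (PathGraph n) 2
pathLabelling n = record { label = direction ; label-injective = injective }
  where
  direction : ∀ {a b} → Adj (PathGraph n) a b → Fin 2
  direction (inj₁ _) = zero
  direction (inj₂ _) = suc zero
  injective : ∀ {a b c} (e : Adj (PathGraph n) a b) (e′ : Adj (PathGraph n) a c) →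
    direction e ≡ direction e′ → b ≡ c
  injective (inj₁ up)   (inj₁ up′)   _ = toℕ-injective (trans up (sym up′))
  injective (inj₂ down) (inj₂ down′) _ = toℕ-injective (ℕ.suc-injective (trans (sym down) down′))

k1Labelling : EdgeLabelling K1 0
k1Labelling = record { label = λ () ; label-injective = λ () }

□-labelling : {G H : Graph} {ΔG ΔH : ℕ} →
  EdgeLabelling G ΔG → EdgeLabelling H ΔH → EdgeLabelling (G □ H) (ΔG + ΔH)
□-labelling {G} {H} {ΔG} {ΔH} LG LH = record
  { label = λ e → join ΔG ΔH (sideLabel e) ; label-injective = injective }
  where
  sideLabel : ∀ {a b} → Adj (G □ H) a b → Fin ΔG ⊎ Fin ΔH
  sideLabel (inj₁ (_ , e)) = inj₂ (label LH e)
  sideLabel (inj₂ (e , _)) = inj₁ (label LG e)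

  join-injective : ∀ {u v} → join ΔG ΔH u ≡ join ΔG ΔH v → u ≡ v
  join-injective {u} {v} eq = trans (sym (splitAt-join ΔG ΔH u))
                                 (trans (cong (splitAt ΔG) eq) (splitAt-join ΔG ΔH v))

  sideLabel-injective : ∀ {a b c} (e : Adj (G □ H) a b) (e′ : Adj (G □ H) a c) →
    sideLabel e ≡ sideLabel e′ → b ≡ c
  sideLabel-injective (inj₁ (refl , e)) (inj₁ (refl , e′)) eq
    rewrite label-injective LH e e′ (Sum.inj₂-injective eq) = refl
  sideLabel-injective (inj₂ (e , refl)) (inj₂ (e′ , refl)) eq
    rewrite label-injective LG e e′ (Sum.inj₁-injective eq) = refl
  sideLabel-injective (inj₁ _) (inj₂ _) ()
  sideLabel-injective (inj₂ _) (inj₁ _) ()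

  injective : ∀ {a b c} (e : Adj (G □ H) a b) (e′ : Adj (G □ H) a c) →
    join ΔG ΔH (sideLabel e) ≡ join ΔG ΔH (sideLabel e′) → b ≡ c
  injective e e′ eq = sideLabel-injective e e′ (join-injective eq)

powerLabelling : (n d : ℕ) → EdgeLabelling (PathGraph n ^□ d) (d * 2)
powerLabelling n zero    = k1Labelling
powerLabelling n (suc d) = □-labelling (pathLabelling n) (powerLabelling n d)

-- Degree bound: in a K_s-immersion the s - 1 paths leaving the branch vertex φ 0
-- start with pairwise distinct edges, so s - 1 is at most the degree of φ 0.
immersion≤degree+1 : {G : Graph} {Δ s : ℕ} → EdgeLabelling G Δ → HasKImmersion G s → s ≤ suc Δ
immersion≤degree+1 {s = zero}  _ _ = z≤n
immersion≤degree+1 {G} {Δ} {suc s} L (φ , φ-injective , P , disjoint) =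
  s≤s (injective⇒≤ {f = firstLabel} firstLabel-injective)
  where
  root≢ : (j : Fin s) → φ zero ≢ φ (suc j)
  root≢ j eq with φ-injective eq
  ... | ()

  leave : (j : Fin s) → Σ (V G) λ c → Adj G (φ zero) c × Step G (walk (P zero (suc j) (s≤s z≤n))) (φ zero) c
  leave j = firstStep (walk (P zero (suc j) (s≤s z≤n))) (root≢ j)

  firstLabel : Fin s → Fin Δ
  firstLabel j = label L (proj₁ (proj₂ (leave j)))

  firstLabel-injective : Injective _≡_ _≡_ firstLabel
  firstLabel-injective {i} {j} eq with i ≟ᶠ j
  ... | yes i≡j = i≡j
  ... | no  i≢j = ⊥-elim (disjoint zero (suc i) (s≤s z≤n) zero (suc j) (s≤s z≤n)
                    (λ (_ , si≡sj) → i≢j (suc-injective si≡sj)) (φ zero) (proj₁ (leave j))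
                    (inj₁ (subst (Step G _ (φ zero)) sameNeighbour (proj₂ (proj₂ (leave i)))))
                    (inj₁ (proj₂ (proj₂ (leave j)))))
    where
    sameNeighbour : proj₁ (leave i) ≡ proj₁ (leave j)
    sameNeighbour = label-injective L (proj₁ (proj₂ (leave i))) (proj₁ (proj₂ (leave j))) eq

-- A graph with decidable equality and adjacency: finite certificates about it
-- can be checked by evaluation.
record DecidableGraph (G : Graph) : Set where
  field
    _≟_  : DecidableEquality (V G)
    adj? : (a b : V G) → Dec (Adj G a b)

pathDecidable : (n : ℕ) → DecidableGraph (PathGraph n)
pathDecidable n = record
  { _≟_  = _≟ᶠ_
  ; adj? = λ x y → (toℕ y ℕ.≟ suc (toℕ x)) ⊎-dec (toℕ x ℕ.≟ suc (toℕ y)) }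

k1Decidable : DecidableGraph K1
k1Decidable = record { _≟_ = Unit._≟_ ; adj? = λ _ _ → no λ () }

□-decidable : {G H : Graph} → DecidableGraph G → DecidableGraph H → DecidableGraph (G □ H)
□-decidable DG DH = record
  { _≟_  = Product.≡-dec (_≟_ DG) (_≟_ DH)
  ; adj? = λ (g , h) (g′ , h′) → ((_≟_ DG g g′) ×-dec adj? DH h h′) ⊎-dec (adj? DG g g′ ×-dec (_≟_ DH h h′)) }
  where open DecidableGraph

powerDecidable : (n d : ℕ) → DecidableGraph (PathGraph n ^□ d)
powerDecidable n zero    = k1Decidable
powerDecidable n (suc d) = □-decidable (pathDecidable n) (powerDecidable n d)

-- Checking an immersion given by its branch vertices and, for each pair i < j,
-- the list of vertices visited by the path from φ i to φ j after leaving φ i.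
module Certificate (G : Graph) (D : DecidableGraph G) where
  open DecidableGraph D
  open import Data.List.Relation.Unary.Unique.DecPropositional _≟_ using (unique?)
  open import Data.List.Membership.DecPropositional (Product.≡-dec _≟_ _≟_) using (_∈?_)

  Route : V G → List (V G) → V G → Set
  Route a []       b = a ≡ b
  Route a (v ∷ vs) b = Adj G a v × Route v vs b

  route? : (a : V G) (vs : List (V G)) (b : V G) → Dec (Route a vs b)
  route? a []       b = a ≟ b
  route? a (v ∷ vs) b = adj? a v ×-dec route? v vs b

  routeWalk : {a b : V G} (vs : List (V G)) → Route a vs b → Walk G a b
  routeWalk []       refl    = stop _
  routeWalk (v ∷ vs) (e , r) = step e (routeWalk vs r)

  vertices-routeWalk : {a b : V G} (vs : List (V G)) (r : Route a vs b) →
    vertices G (routeWalk vs r) ≡ a ∷ vs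
  vertices-routeWalk []       refl    = refl
  vertices-routeWalk (v ∷ vs) (e , r) = cong (_ ∷_) (vertices-routeWalk vs r)

  edges : V G → List (V G) → List (V G × V G)
  edges a []       = []
  edges a (v ∷ vs) = (a , v) ∷ edges v vs

  step⇒edge : {a b x y : V G} (vs : List (V G)) (r : Route a vs b) →
    Step G (routeWalk vs r) x y → (x , y) ∈ edges a vs
  step⇒edge []       refl    ()
  step⇒edge (v ∷ vs) (e , r) (inj₁ (refl , refl)) = here refl
  step⇒edge (v ∷ vs) (e , r) (inj₂ s)             = there (step⇒edge vs r s)

  EdgeDisjointLists : List (V G × V G) → List (V G × V G) → Set
  EdgeDisjointLists es fs = All (λ e → e ∉ fs × swap e ∉ fs) es

  routes-edgeDisjoint : {a b c d : V G} (vs ws : List (V G)) (r : Route a vs b) (r′ : Route c ws d) →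
    EdgeDisjointLists (edges a vs) (edges c ws) →
    ∀ x y → UsesEdge G (routeWalk vs r) x y → ¬ UsesEdge G (routeWalk ws r′) x y
  routes-edgeDisjoint vs ws r r′ D x y (inj₁ s) (inj₁ s′) = proj₁ (All.lookup D (step⇒edge vs r s)) (step⇒edge ws r′ s′)
  routes-edgeDisjoint vs ws r r′ D x y (inj₁ s) (inj₂ s′) = proj₂ (All.lookup D (step⇒edge vs r s)) (step⇒edge ws r′ s′)
  routes-edgeDisjoint vs ws r r′ D x y (inj₂ s) (inj₁ s′) = proj₂ (All.lookup D (step⇒edge vs r s)) (step⇒edge ws r′ s′)
  routes-edgeDisjoint vs ws r r′ D x y (inj₂ s) (inj₂ s′) = proj₁ (All.lookup D (step⇒edge vs r s)) (step⇒edge ws r′ s′)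

  module _ {t : ℕ} (φ : Fin t → V G) (route : Fin t → Fin t → List (V G)) where

    Certifies : Set
    Certifies = (∀ i j → φ i ≡ φ j → i ≡ j)
              × (∀ i j → i <ᶠ j → Route (φ i) (route i j) (φ j) × Unique (φ i ∷ route i j))
              × (∀ i j k l → i <ᶠ j → k <ᶠ l → ¬ (i ≡ k × j ≡ l) →
                   EdgeDisjointLists (edges (φ i) (route i j)) (edges (φ k) (route k l)))

    certifies? : Dec Certifies
    certifies? =
      all? (λ i → all? λ j → (φ i ≟ φ j) →-dec (i ≟ᶠ j))
      ×-dec all? (λ i → all? λ j → (i <ᶠ? j) →-dec (route? (φ i) (route i j) (φ j) ×-dec unique? (φ i ∷ route i j)))
      ×-dec all? (λ i → all? λ j → all? λ k → all? λ l →
               (i <ᶠ? j) →-dec (k <ᶠ? l) →-dec ¬? ((i ≟ᶠ k) ×-dec (j ≟ᶠ l)) →-dec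
               All.all? (λ e → ¬? (e ∈? edges (φ k) (route k l)) ×-dec ¬? (swap e ∈? edges (φ k) (route k l)))
                        (edges (φ i) (route i j)))

    certified⇒immersion : Certifies → HasKImmersion G t
    certified⇒immersion (injective , valid , disjoint) = φ , (λ {i} {j} → injective i j) , path , pathsDisjoint
      where
      path : (i j : Fin t) → i <ᶠ j → Path G (φ i) (φ j)
      path i j i<j = record
        { walk     = routeWalk (route i j) (proj₁ (valid i j i<j))
        ; distinct = subst Unique (sym (vertices-routeWalk (route i j) _)) (proj₂ (valid i j i<j)) }

      pathsDisjoint : ∀ i j (i<j : i <ᶠ j) k l (k<l : k <ᶠ l) → ¬ (i ≡ k × j ≡ l) →
        EdgeDisjoint G (path i j i<j) (path k l k<l)
      pathsDisjoint i j i<j k l k<l ne = routes-edgeDisjoint (route i j) (route k l) _ _ (disjoint i j k l i<j k<l ne)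

record SpareImmersion (G : Graph) (t : ℕ) : Set where
  field
    immersion : HasKImmersion G (suc t)
    spare     : V G

  φ : Fin (suc t) → V G
  φ = proj₁ immersion

  field
    root→spare : Adj G (φ zero) spare
    spare→root : Adj G spare (φ zero)
    spare-free : ∀ i → φ i ≢ spare

  φ-injective : Injective _≡_ _≡_ φ
  φ-injective = proj₁ (proj₂ immersion)

  P : (i j : Fin (suc t)) → i <ᶠ j → Path G (φ i) (φ j)
  P = proj₁ (proj₂ (proj₂ immersion))

  P-disjoint : ∀ i j (i<j : i <ᶠ j) k l (k<l : k <ᶠ l) → ¬ (i ≡ k × j ≡ l) →
    EdgeDisjoint G (P i j i<j) (P k l k<l)
  P-disjoint = proj₂ (proj₂ (proj₂ immersion))

-- The extension step: a spare K_{t+1}-immersion in G yields a spare K_{t+3}-immersion in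
-- P_N □ G for N ≥ 5.  Write root = φ 0 and use the layers l0, …, l4 (copies ℓ × G).
-- The new branch vertices are (l3 , root), (l1 , root) and the old ones lifted to the
-- middle layer l2.  Old paths are lifted to l2; the "fan" from (l3 or l1 , root) to
-- (l2 , φ j) follows the old path root → φ j inside its layer and then takes the vertical
-- "rung" down/up to l2; the two new vertices are joined by an outer path through the rim
-- layers l0 and l4, crossing the inner layers only in the column of the spare vertex.
-- Each kind of path lives in its own class of edges, which gives edge-disjointness.
-- The new spare vertex is (l4 , root).
module Extension (m : ℕ) {G : Graph} {t : ℕ} (I : SpareImmersion G t) where
  open SpareImmersion I

  N : ℕ
  N = 5 + m

  H : Graph
  H = PathGraph N □ G

  root : V G
  root = φ zero

  l0 l1 l2 l3 l4 : Fin N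
  l0 = zero
  l1 = suc zero
  l2 = suc (suc zero)
  l3 = suc (suc (suc zero))
  l4 = suc (suc (suc (suc zero)))

  data Side : Set where
    upper lower : Side

  layer : Side → Fin N
  layer upper = l3
  layer lower = l1

  rungEdge : (s : Side) → Adj (PathGraph N) (layer s) l2
  rungEdge upper = inj₂ refl
  rungEdge lower = inj₁ refl

  data InLayer (ℓ : Fin N) (R : V G → V G → Set) : V H → V H → Set where
    within : ∀ {g h} → R g h → InLayer ℓ R (ℓ , g) (ℓ , h)

  data Rung (s : Side) (g : V G) : V H → V H → Set where
    down : Rung s g (layer s , g) (l2 , g)
    up   : Rung s g (l2 , g) (layer s , g)

  rung-sym : ∀ {s g x y} → Rung s g x y → Rung s g y x
  rung-sym down = up
  rung-sym up   = down

  OnRim : V H → Set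
  OnRim (a , _) = a ≡ l0 ⊎ a ≡ l4

  Inner : V H → Set
  Inner (a , _) = a ≡ l1 ⊎ a ≡ l2 ⊎ a ≡ l3

  inner-off-rim : {x : V H} → Inner x → ¬ OnRim x
  inner-off-rim (inj₁ refl)        (inj₁ ())
  inner-off-rim (inj₁ refl)        (inj₂ ())
  inner-off-rim (inj₂ (inj₁ refl)) (inj₁ ())
  inner-off-rim (inj₂ (inj₁ refl)) (inj₂ ())
  inner-off-rim (inj₂ (inj₂ refl)) (inj₁ ())
  inner-off-rim (inj₂ (inj₂ refl)) (inj₂ ())

  rung≠inLayer : ∀ {s g ℓ R x y} → Rung s g x y → ¬ InLayer ℓ R x y
  rung≠inLayer {upper} down ()
  rung≠inLayer {lower} down ()
  rung≠inLayer {upper} up   ()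
  rung≠inLayer {lower} up   ()

  rung-unique : ∀ {s s′ g g′ x y} → Rung s g x y → Rung s′ g′ x y → s ≡ s′ × g ≡ g′
  rung-unique {upper} {upper} down down = refl , refl
  rung-unique {lower} {lower} down down = refl , refl
  rung-unique {upper} {upper} up   up   = refl , refl
  rung-unique {lower} {lower} up   up   = refl , refl
  rung-unique {upper} {lower} down ()
  rung-unique {lower} {upper} down ()
  rung-unique {upper} {lower} up   ()
  rung-unique {lower} {upper} up   ()

  rootPath : (j : Fin (suc t)) → Path G root (φ j)
  rootPath zero    = trivialPath root
  rootPath (suc j) = P zero (suc j) (s≤s z≤n)

  RootEdge : Fin (suc t) → V G → V G → Set
  RootEdge j = UsesEdge G (walk (rootPath j))

  rootPaths-disjoint : ∀ {j j′} → j ≢ j′ → ∀ {g h} → RootEdge j g h → ¬ RootEdge j′ g h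
  rootPaths-disjoint {zero}              _ (inj₁ ())
  rootPaths-disjoint {zero}              _ (inj₂ ())
  rootPaths-disjoint {suc j} {zero}      _ _ (inj₁ ())
  rootPaths-disjoint {suc j} {zero}      _ _ (inj₂ ())
  rootPaths-disjoint {suc j} {suc j′} j≢j′ =
    P-disjoint zero (suc j) (s≤s z≤n) zero (suc j′) (s≤s z≤n) (λ (_ , sj≡sj′) → j≢j′ sj≡sj′) _ _

  lift : Fin N → V G → V H
  lift ℓ g = ℓ , g

  liftEdge : (ℓ : Fin N) → ∀ {g h} → Adj G g h → Adj H (lift ℓ g) (lift ℓ h)
  liftEdge ℓ e = inj₁ (refl , e)

  liftPath : (ℓ : Fin N) → ∀ {g h} → Path G g h → Path H (lift ℓ g) (lift ℓ h)
  liftPath ℓ = mapPath (lift ℓ) (liftEdge ℓ) (cong proj₂)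

  uses-lift : (ℓ : Fin N) → ∀ {g h} (w : Walk G g h) {x y} →
    UsesEdge H (mapWalk (lift ℓ) (liftEdge ℓ) w) x y → InLayer ℓ (UsesEdge G w) x y
  uses-lift ℓ w u with usesEdge-mapWalk (lift ℓ) (liftEdge ℓ) w u
  ... | _ , _ , u′ , refl , refl = within u′

  fan : (s : Side) (j : Fin (suc t)) → Path H (layer s , root) (l2 , φ j)
  fan s j = extendPath (liftPath (layer s) (rootPath j)) (inj₂ (rungEdge s , refl)) (foot∉copy s)
    where
    foot∉copy : ∀ s → (l2 , φ j) ∉ vertices H (walk (liftPath (layer s) (rootPath j)))
    foot∉copy s foot∈ with ∈-map⁻ (lift (layer s)) (subst ((l2 , φ j) ∈_)
                              (vertices-mapWalk (lift (layer s)) (liftEdge (layer s)) (walk (rootPath j))) foot∈)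
    foot∉copy upper _ | _ , _ , ()
    foot∉copy lower _ | _ , _ , ()

  FanEdge : Side → Fin (suc t) → V H → V H → Set
  FanEdge s j x y = InLayer (layer s) (RootEdge j) x y ⊎ Rung s (φ j) x y

  uses-fan : (s : Side) (j : Fin (suc t)) {x y : V H} → UsesEdge H (walk (fan s j)) x y → FanEdge s j x y
  uses-fan s j (inj₁ st) with step-▷ (walk (liftPath (layer s) (rootPath j))) (inj₂ (rungEdge s , refl)) st
  ... | inj₁ st′         = inj₁ (uses-lift (layer s) (walk (rootPath j)) (inj₁ st′))
  ... | inj₂ (refl , refl) = inj₂ down
  uses-fan s j (inj₂ st) with step-▷ (walk (liftPath (layer s) (rootPath j))) (inj₂ (rungEdge s , refl)) st
  ... | inj₁ st′         = inj₁ (uses-lift (layer s) (walk (rootPath j)) (inj₂ st′))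
  ... | inj₂ (refl , refl) = inj₂ up

  -- The outer path from (l3 , root) to (l1 , root): out to the rim layer l4, across to the
  -- spare column, down that column to the rim layer l0, and back to the root column:
  -- (l3,root) (l4,root) (l4,spare) (l3,spare) (l2,spare) (l1,spare) (l0,spare) (l0,root) (l1,root).
  outerWalk : Walk H (l3 , root) (l1 , root)
  outerWalk =
    step (inj₂ (inj₁ refl , refl)) (step (liftEdge l4 root→spare) (step (inj₂ (inj₂ refl , refl))
    (step (inj₂ (inj₂ refl , refl)) (step (inj₂ (inj₂ refl , refl)) (step (inj₂ (inj₂ refl , refl))
    (step (liftEdge l0 spare→root) (step (inj₂ (inj₁ refl , refl)) (stop _))))))))

  -- Its vertices are distinct: they are (layer , column) pairs with distinct tags and
  -- the two columns root ≠ spare.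
  outerPath : Path H (l3 , root) (l1 , root)
  outerPath = record { walk = outerWalk ; distinct = Unique.map⁺ place-injective tagsDistinct }
    where
    column : Bool → V G
    column true  = root
    column false = spare

    place : Fin N × Bool → V H
    place (ℓ , b) = ℓ , column b

    column-injective : Injective _≡_ _≡_ column
    column-injective {true}  {true}  _  = refl
    column-injective {false} {false} _  = refl
    column-injective {true}  {false} eq = ⊥-elim (spare-free zero eq)
    column-injective {false} {true}  eq = ⊥-elim (spare-free zero (sym eq))

    place-injective : Injective _≡_ _≡_ place
    place-injective {ℓ , b} {ℓ′ , b′} eq
      rewrite cong proj₁ eq | column-injective {b} {b′} (cong proj₂ eq) = refl

    open import Data.List.Relation.Unary.Unique.DecPropositional (Product.≡-dec _≟ᶠ_ Bool._≟_) using (unique?)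
    tags : List (Fin N × Bool)
    tags = (l3 , true) ∷ (l4 , true) ∷ (l4 , false) ∷ (l3 , false) ∷ (l2 , false) ∷
           (l1 , false) ∷ (l0 , false) ∷ (l0 , true) ∷ (l1 , true) ∷ []

    tagsDistinct : Unique tags
    tagsDistinct = toWitness {a? = unique? tags} tt

  OuterEdge : V H → V H → Set
  OuterEdge x y = OnRim x ⊎ OnRim y ⊎ Rung upper spare x y ⊎ Rung lower spare x y

  outerEdge-sym : ∀ {x y} → OuterEdge x y → OuterEdge y x
  outerEdge-sym (inj₁ r)                    = inj₂ (inj₁ r)
  outerEdge-sym (inj₂ (inj₁ r))             = inj₁ r
  outerEdge-sym (inj₂ (inj₂ (inj₁ rung)))   = inj₂ (inj₂ (inj₁ (rung-sym rung)))
  outerEdge-sym (inj₂ (inj₂ (inj₂ rung)))   = inj₂ (inj₂ (inj₂ (rung-sym rung)))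

  outer-steps : ∀ {x y} → Step H outerWalk x y → OuterEdge x y
  outer-steps (inj₁ (refl , refl))                                                 = inj₂ (inj₁ (inj₂ refl))
  outer-steps (inj₂ (inj₁ (refl , refl)))                                          = inj₁ (inj₂ refl)
  outer-steps (inj₂ (inj₂ (inj₁ (refl , refl))))                                   = inj₁ (inj₂ refl)
  outer-steps (inj₂ (inj₂ (inj₂ (inj₁ (refl , refl)))))                            = inj₂ (inj₂ (inj₁ down))
  outer-steps (inj₂ (inj₂ (inj₂ (inj₂ (inj₁ (refl , refl))))))                     = inj₂ (inj₂ (inj₂ up))
  outer-steps (inj₂ (inj₂ (inj₂ (inj₂ (inj₂ (inj₁ (refl , refl)))))))              = inj₂ (inj₁ (inj₁ refl))
  outer-steps (inj₂ (inj₂ (inj₂ (inj₂ (inj₂ (inj₂ (inj₁ (refl , refl))))))))       = inj₁ (inj₁ refl)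
  outer-steps (inj₂ (inj₂ (inj₂ (inj₂ (inj₂ (inj₂ (inj₂ (inj₁ (refl , refl))))))))) = inj₁ (inj₁ refl)

  uses-outer : ∀ {x y} → UsesEdge H outerWalk x y → OuterEdge x y
  uses-outer (inj₁ st) = outer-steps st
  uses-outer (inj₂ st) = outerEdge-sym (outer-steps st)

  -- Every fan edge and every middle-layer edge joins two inner layers; so an outer edge
  -- can meet them only in one of its two rungs at the spare column.
  fan-inner : ∀ {s j x y} → FanEdge s j x y → Inner x × Inner y
  fan-inner {upper} (inj₁ (within _)) = inj₂ (inj₂ refl) , inj₂ (inj₂ refl)
  fan-inner {lower} (inj₁ (within _)) = inj₁ refl , inj₁ refl
  fan-inner {upper} (inj₂ down)       = inj₂ (inj₂ refl) , inj₂ (inj₁ refl)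
  fan-inner {lower} (inj₂ down)       = inj₁ refl , inj₂ (inj₁ refl)
  fan-inner {upper} (inj₂ up)         = inj₂ (inj₁ refl) , inj₂ (inj₂ refl)
  fan-inner {lower} (inj₂ up)         = inj₂ (inj₁ refl) , inj₁ refl

  middle-inner : ∀ {R x y} → InLayer l2 R x y → Inner x × Inner y
  middle-inner (within _) = inj₂ (inj₁ refl) , inj₂ (inj₁ refl)

  outer-inner : ∀ {x y} → OuterEdge x y → Inner x × Inner y → Σ Side λ s → Rung s spare x y
  outer-inner {x} (inj₁ rim)            (ix , _)  = ⊥-elim (inner-off-rim {x} ix rim)
  outer-inner {y = y} (inj₂ (inj₁ rim)) (_ , iy)  = ⊥-elim (inner-off-rim {y} iy rim)
  outer-inner (inj₂ (inj₂ (inj₁ rung))) _         = upper , rung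
  outer-inner (inj₂ (inj₂ (inj₂ rung))) _         = lower , rung

  outer∩fan : ∀ {s j x y} → OuterEdge x y → ¬ FanEdge s j x y
  outer∩fan {j = j} o f with outer-inner o (fan-inner f)
  outer∩fan o (inj₁ flat) | _ , rung = rung≠inLayer rung flat
  outer∩fan {j = j} o (inj₂ rung′) | _ , rung = spare-free j (sym (proj₂ (rung-unique rung rung′)))

  outer∩middle : ∀ {R x y} → OuterEdge x y → ¬ InLayer l2 R x y
  outer∩middle o flat = rung≠inLayer (proj₂ (outer-inner o (middle-inner flat))) flat

  fan∩fan : ∀ {s j j′ x y} → j ≢ j′ → FanEdge s j x y → ¬ FanEdge s j′ x y
  fan∩fan {upper} j≢j′ (inj₁ (within u)) (inj₁ (within u′)) = rootPaths-disjoint j≢j′ u u′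
  fan∩fan {lower} j≢j′ (inj₁ (within u)) (inj₁ (within u′)) = rootPaths-disjoint j≢j′ u u′
  fan∩fan j≢j′ (inj₁ flat)              (inj₂ rung)        = rung≠inLayer rung flat
  fan∩fan j≢j′ (inj₂ rung)              (inj₁ flat)        = rung≠inLayer rung flat
  fan∩fan j≢j′ (inj₂ rung)              (inj₂ rung′)       = j≢j′ (φ-injective (proj₂ (rung-unique rung rung′)))

  upperFan∩lowerFan : ∀ {j j′ x y} → FanEdge upper j x y → ¬ FanEdge lower j′ x y
  upperFan∩lowerFan (inj₁ (within _)) (inj₁ ())
  upperFan∩lowerFan (inj₁ flat)        (inj₂ rung)        = rung≠inLayer rung flat
  upperFan∩lowerFan (inj₂ rung)        (inj₁ flat)        = rung≠inLayer rung flat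
  upperFan∩lowerFan (inj₂ rung)        (inj₂ rung′) with rung-unique rung rung′
  ... | () , _

  fan∩middle : ∀ {s j R x y} → FanEdge s j x y → ¬ InLayer l2 R x y
  fan∩middle {upper} (inj₁ (within _)) ()
  fan∩middle {lower} (inj₁ (within _)) ()
  fan∩middle         (inj₂ rung)       flat = rung≠inLayer rung flat

  φ′ : Fin (3 + t) → V H
  φ′ zero          = l3 , root
  φ′ (suc zero)    = l1 , root
  φ′ (suc (suc i)) = l2 , φ i

  φ′-injective : Injective _≡_ _≡_ φ′
  φ′-injective {zero}          {zero}          _  = refl
  φ′-injective {suc zero}      {suc zero}      _  = refl
  φ′-injective {suc (suc i)}   {suc (suc j)}   eq = cong (λ k → suc (suc k)) (φ-injective (cong proj₂ eq))
  φ′-injective {zero}          {suc zero}      ()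
  φ′-injective {zero}          {suc (suc _)}   ()
  φ′-injective {suc zero}      {zero}          ()
  φ′-injective {suc zero}      {suc (suc _)}   ()
  φ′-injective {suc (suc _)}   {zero}          ()
  φ′-injective {suc (suc _)}   {suc zero}      ()

  data NewPair : Fin (3 + t) → Fin (3 + t) → Set where
    outerPair : NewPair zero (suc zero)
    upperFan  : (j : Fin (suc t)) → NewPair zero (suc (suc j))
    lowerFan  : (j : Fin (suc t)) → NewPair (suc zero) (suc (suc j))
    middle    : {i j : Fin (suc t)} → i <ᶠ j → NewPair (suc (suc i)) (suc (suc j))

  classify : {i j : Fin (3 + t)} → i <ᶠ j → NewPair i j
  classify {zero}        {suc zero}    _                  = outerPair
  classify {zero}        {suc (suc j)} _                  = upperFan j
  classify {suc zero}    {suc (suc j)} _                  = lowerFan j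
  classify {suc (suc i)} {suc (suc j)} (s≤s (s≤s i<j))    = middle i<j
  classify {suc zero}    {suc zero}    (s≤s ())
  classify {suc (suc i)} {suc zero}    (s≤s ())

  newPath : {i j : Fin (3 + t)} → NewPair i j → Path H (φ′ i) (φ′ j)
  newPath outerPair    = outerPath
  newPath (upperFan j) = fan upper j
  newPath (lowerFan j) = fan lower j
  newPath (middle {i} {j} i<j) = liftPath l2 (P i j i<j)

  Zone : {i j : Fin (3 + t)} → NewPair i j → V H → V H → Set
  Zone outerPair            = OuterEdge
  Zone (upperFan j)         = FanEdge upper j
  Zone (lowerFan j)         = FanEdge lower j
  Zone (middle {i} {j} i<j) = InLayer l2 (UsesEdge G (walk (P i j i<j)))

  uses-zone : {i j : Fin (3 + t)} (p : NewPair i j) {x y : V H} → UsesEdge H (walk (newPath p)) x y → Zone p x y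
  uses-zone outerPair            = uses-outer
  uses-zone (upperFan j)         = uses-fan upper j
  uses-zone (lowerFan j)         = uses-fan lower j
  uses-zone (middle {i} {j} i<j) = uses-lift l2 (walk (P i j i<j))

  zones-disjoint : {i j k l : Fin (3 + t)} (p : NewPair i j) (q : NewPair k l) → ¬ (i ≡ k × j ≡ l) →
    ∀ {x y} → Zone p x y → ¬ Zone q x y
  zones-disjoint outerPair    outerPair     ne = ⊥-elim (ne (refl , refl))
  zones-disjoint outerPair    (upperFan _)  _  = outer∩fan
  zones-disjoint outerPair    (lowerFan _)  _  = outer∩fan
  zones-disjoint outerPair    (middle _)    _  = outer∩middle
  zones-disjoint (upperFan _) outerPair     _  = λ z z′ → outer∩fan z′ z
  zones-disjoint (upperFan _) (upperFan _)  ne = fan∩fan (λ j≡j′ → ne (refl , cong (λ k → suc (suc k)) j≡j′))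
  zones-disjoint (upperFan _) (lowerFan _)  _  = upperFan∩lowerFan
  zones-disjoint (upperFan _) (middle _)    _  = fan∩middle
  zones-disjoint (lowerFan _) outerPair     _  = λ z z′ → outer∩fan z′ z
  zones-disjoint (lowerFan _) (upperFan _)  _  = λ z z′ → upperFan∩lowerFan z′ z
  zones-disjoint (lowerFan _) (lowerFan _)  ne = fan∩fan (λ j≡j′ → ne (refl , cong (λ k → suc (suc k)) j≡j′))
  zones-disjoint (lowerFan _) (middle _)    _  = fan∩middle
  zones-disjoint (middle _)   outerPair     _  = λ z z′ → outer∩middle z′ z
  zones-disjoint (middle _)   (upperFan _)  _  = λ z z′ → fan∩middle z′ z
  zones-disjoint (middle _)   (lowerFan _)  _  = λ z z′ → fan∩middle z′ z
  zones-disjoint (middle {i} {j} i<j) (middle {k} {l} k<l) ne (within u) (within u′) =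
    P-disjoint i j i<j k l k<l (λ (i≡k , j≡l) → ne (cong (λ a → suc (suc a)) i≡k , cong (λ a → suc (suc a)) j≡l)) _ _ u u′

  extended : SpareImmersion H (2 + t)
  extended = record
    { immersion  = φ′ , φ′-injective , (λ i j i<j → newPath (classify i<j))
                 , λ i j i<j k l k<l ne x y u u′ →
                     zones-disjoint (classify i<j) (classify k<l) ne (uses-zone (classify i<j) u) (uses-zone (classify k<l) u′)
    ; spare      = l4 , root
    ; root→spare = inj₂ (inj₁ refl , refl)
    ; spare→root = inj₂ (inj₂ refl , refl)
    ; spare-free = λ { zero () ; (suc zero) () ; (suc (suc _)) () } }

-- The base case d = 3: an explicit spare K_7-immersion in P_n^3 for n = 6 + m, whose
-- vertices have coordinates at most 5.  Paths are given by the vertices they visit after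
-- leaving their start; all conditions are checked by evaluation.
module Base (m : ℕ) where
  open import Agda.Builtin.FromNat using (Number; fromNat)

  instance
    natLiterals : Number ℕ
    natLiterals = NatLiterals.number

    finLiterals : ∀ {n} → Number (Fin n)
    finLiterals {n} = FinLiterals.number n

  G₃ : Graph
  G₃ = PathGraph (6 + m) ^□ 3

  open DecidableGraph (powerDecidable (6 + m) 3)
  open Certificate G₃ (powerDecidable (6 + m) 3)

  pt : Fin 6 → Fin 6 → Fin 6 → V G₃
  pt a b c = a ↑ˡ m , b ↑ˡ m , c ↑ˡ m , tt

  branch : Fin 7 → V G₃
  branch = lookup (pt 2 1 2 ∷ pt 3 2 1 ∷ pt 4 2 3 ∷ pt 4 1 4 ∷ pt 4 1 1 ∷ pt 1 2 1 ∷ pt 2 1 1 ∷ [])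

  routeTable : List (ℕ × ℕ × List (V G₃))
  routeTable =
    (0 , 1 , pt 2 0 2 ∷ pt 3 0 2 ∷ pt 3 1 2 ∷ pt 3 2 2 ∷ pt 3 2 1 ∷ []) ∷
    (0 , 2 , pt 2 2 2 ∷ pt 3 2 2 ∷ pt 3 2 3 ∷ pt 4 2 3 ∷ []) ∷
    (0 , 3 , pt 2 1 3 ∷ pt 2 1 4 ∷ pt 2 1 5 ∷ pt 3 1 5 ∷ pt 4 1 5 ∷ pt 4 1 4 ∷ []) ∷
    (0 , 4 , pt 3 1 2 ∷ pt 3 1 1 ∷ pt 4 1 1 ∷ []) ∷
    (0 , 5 , pt 1 1 2 ∷ pt 0 1 2 ∷ pt 0 2 2 ∷ pt 0 2 1 ∷ pt 1 2 1 ∷ []) ∷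
    (0 , 6 , pt 2 1 1 ∷ []) ∷
    (1 , 2 , pt 4 2 1 ∷ pt 4 2 2 ∷ pt 4 2 3 ∷ []) ∷
    (1 , 3 , pt 3 3 1 ∷ pt 4 3 1 ∷ pt 4 3 2 ∷ pt 4 3 3 ∷ pt 4 3 4 ∷ pt 4 2 4 ∷ pt 4 1 4 ∷ []) ∷
    (1 , 4 , pt 3 1 1 ∷ pt 3 0 1 ∷ pt 4 0 1 ∷ pt 4 1 1 ∷ []) ∷
    (1 , 5 , pt 2 2 1 ∷ pt 2 2 0 ∷ pt 1 2 0 ∷ pt 1 2 1 ∷ []) ∷
    (1 , 6 , pt 3 2 0 ∷ pt 3 1 0 ∷ pt 3 1 1 ∷ pt 2 1 1 ∷ []) ∷
    (2 , 3 , pt 4 2 4 ∷ pt 5 2 4 ∷ pt 5 1 4 ∷ pt 4 1 4 ∷ []) ∷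
    (2 , 4 , pt 5 2 3 ∷ pt 5 1 3 ∷ pt 5 1 2 ∷ pt 5 1 1 ∷ pt 4 1 1 ∷ []) ∷
    (2 , 5 , pt 4 3 3 ∷ pt 3 3 3 ∷ pt 2 3 3 ∷ pt 1 3 3 ∷ pt 1 3 2 ∷ pt 1 3 1 ∷ pt 1 2 1 ∷ []) ∷
    (2 , 6 , pt 4 1 3 ∷ pt 3 1 3 ∷ pt 2 1 3 ∷ pt 1 1 3 ∷ pt 1 1 2 ∷ pt 1 1 1 ∷ pt 2 1 1 ∷ []) ∷
    (3 , 4 , pt 4 1 3 ∷ pt 4 1 2 ∷ pt 4 1 1 ∷ []) ∷
    (3 , 5 , pt 3 1 4 ∷ pt 2 1 4 ∷ pt 1 1 4 ∷ pt 1 2 4 ∷ pt 1 2 3 ∷ pt 1 2 2 ∷ pt 1 2 1 ∷ []) ∷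
    (3 , 6 , pt 4 0 4 ∷ pt 3 0 4 ∷ pt 2 0 4 ∷ pt 2 0 3 ∷ pt 2 0 2 ∷ pt 2 0 1 ∷ pt 2 1 1 ∷ []) ∷
    (4 , 5 , pt 4 2 1 ∷ pt 4 2 0 ∷ pt 3 2 0 ∷ pt 2 2 0 ∷ pt 2 1 0 ∷ pt 1 1 0 ∷ pt 1 1 1 ∷ pt 1 2 1 ∷ []) ∷
    (4 , 6 , pt 4 1 0 ∷ pt 3 1 0 ∷ pt 2 1 0 ∷ pt 2 1 1 ∷ []) ∷
    (5 , 6 , pt 2 2 1 ∷ pt 2 1 1 ∷ []) ∷ []

  -- Looking up a route.
  route : Fin 7 → Fin 7 → List (V G₃)
  route i j = find routeTable
    where
    find : List (ℕ × ℕ × List (V G₃)) → List (V G₃)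
    find []                  = []
    find ((a , b , vs) ∷ rs) = if (a ≡ᵇ toℕ i) ∧ (b ≡ᵇ toℕ j) then vs else find rs

  immersion : HasKImmersion G₃ 7
  immersion = certified⇒immersion branch route (toWitness {a? = certifies? branch route} tt)

  spareBase : SpareImmersion G₃ 6
  spareBase = record
    { immersion  = immersion
    ; spare      = pt 1 1 2
    ; root→spare = toWitness {a? = adj? (branch zero) (pt 1 1 2)} tt
    ; spare→root = toWitness {a? = adj? (pt 1 1 2) (branch zero)} tt
    ; spare-free = toWitness {a? = all? λ i → ¬? (branch i ≟ pt 1 1 2)} tt }

spareImmersion : (m k : ℕ) → SpareImmersion (PathGraph (6 + m) ^□ (3 + k)) (6 + k * 2)
spareImmersion m zero    = Base.spareBase m
spareImmersion m (suc k) = Extension.extended (suc m) (spareImmersion m k)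

-- The theorem for n = 6 + m and d = 3 + k, with 2d + 1 written as suc (d * 2).
immersionNumber : (m k : ℕ) → ImmersionNumberIs (PathGraph (6 + m) ^□ (3 + k)) (suc ((3 + k) * 2))
immersionNumber m k = SpareImmersion.immersion (spareImmersion m k)
                    , λ s → immersion≤degree+1 (powerLabelling (6 + m) (3 + k))

suc[d*2]≡2*d+1 : (d : ℕ) → suc (d * 2) ≡ 2 * d + 1
suc[d*2]≡2*d+1 d = trans (cong suc (*-comm d 2)) (+-comm 1 (2 * d))

corollary18 : (n d : ℕ) → 6 ≤ n → 2 < d →
    ImmersionNumberIs (PathGraph n ^□ d) (2 * d + 1)
corollary18 n d 6≤n 2<d
  with m , refl ← m≤n⇒∃[o]m+o≡n 6≤n
     | k , refl ← m≤n⇒∃[o]m+o≡n 2<d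
  = subst (ImmersionNumberIs (PathGraph (6 + m) ^□ (3 + k))) (suc[d*2]≡2*d+1 (3 + k)) (immersionNumber m k)
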